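{- If a (proper) cross-sequent $\mathcal{S}$ is saturated, then $\mathcal{S}$ is not valid.
   Context: Formulas over a countably infinite set $\mathrm{Prop}$ of atoms and finite nonempty agent set $A$, in negation normal form: $\phi::=\bot\mid\top\mid p\mid\neg p\mid(\phi\wedge\phi)\mid(\phi\vee\phi)\mid\Box_a\phi\mid\Diamond_a\phi$. An epistemic model $\mathcal{M}=(W,R,V)$: $W\neq\varnothing$, $R_a$ an equivalence relation on $W$ for each $a\in A$, $V:\mathrm{Prop}\to\mathcal{P}(W)$; standard truth. A sequent is a finite set of formulas. Cross-sequents/hypersequents by mutual recursion: every sequent is a cross-sequent; a hypersequent $H=\mathcal{S}_1|\dots|\mathcal{S}_m$ ($m\ge1$) is a finite multiset of cross-sequents; if $\mathcal{S}$ is a cross-sequent, $a\in A$, $H$ a hypersequent, then $\mathcal{S},[H]_a$ is a cross-sequent. A cross-sequent is a finite tree of sequents (components); the roots of members of $H$ are the $a$-children of the root of $\mathcal{S},[H]_a$ (their $a$-parent) and $a$-siblings of each other. Proper: (a) each component has at most one $a$-bracket per agent; (b) no $a$-child is an $a$-parent. The $a$-cluster $[\Gamma]_a$ of a component $\Gamma$: $\Gamma$, its $a$-parent, $a$-siblings and $a$-children. A labeling assigns distinct nonnegative integers to components (root $0$). An interpretation of labeled $\mathcal{S}$ into $\mathcal{M}$ maps a superset of its labels into $W$ so that $\Delta\in[\Gamma]_a$ implies $[\ell(\Gamma)]R_a[\ell(\Delta)]$; $\mathcal{M},[\cdot]\vDash\mathcal{S}$ iff some formula of some component $\Gamma$ is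 true at $[\ell(\Gamma)]$; $\mathcal{S}$ is valid iff $\mathcal{M},[\cdot]\vDash\mathcal{S}$ for all epistemic models $\mathcal{M}$ and interpretations $[\cdot]$. Saturation: an occurrence of $\phi$ in component $\Gamma$ is saturated iff: $\top$ never; $\bot$ always; a literal iff its opposite literal is not in $\Gamma$; $\phi\vee\psi$ iff $\{\phi,\psi\}\subseteq\Gamma$; $\phi\wedge\psi$ iff $\{\phi,\psi\}\cap\Gamma\neq\varnothing$; $\Box_a\phi$ iff $\phi\in\Delta$ for some $\Delta\in[\Gamma]_a$; $\Diamond_a\phi$ iff $\phi\in\Delta$ for every $\Delta\in[\Gamma]_a$. A cross-sequent is saturated iff all its formulas are saturated. -}

module Defs where

open import Level using (Level)
open import Data.Nat using (ℕ)
open import Data.Fin using (Fin)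
open import Data.Product using (Σ; _×_; _,_)
open import Data.Sum using (_⊎_)
open import Data.Empty renaming (⊥ to Empty)
open import Data.Unit renaming (⊤ to Unit)
open import Data.List using (List)
open import Data.List.NonEmpty using (List⁺; toList)
open import Data.List.Membership.Propositional using (_∈_; _∉_)
open import Data.List.Relation.Unary.Any using (index)
open import Relation.Nullary using (¬_)
open import Relation.Binary.PropositionalEquality using (_≡_)
open import Relation.Binary.Structures using (IsEquivalence)

data Form (Ag : Set) : Set where
  ⊥f ⊤f  : Form Ag
  var    : ℕ → Form Ag
  nvar   : ℕ → Form Ag
  _∧f_   : Form Ag → Form Ag → Form Ag
  _∨f_   : Form Ag → Form Ag → Form Ag
  □      : Ag → Form Ag → Form Ag
  ◇      : Ag → Form Ag → Form Ag

record Model (Ag : Set) : Set₁ where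
  field
    W    : Set
    w₀   : W
    R    : Ag → W → W → Set
    Req  : ∀ a → IsEquivalence (R a)
    V    : ℕ → W → Set

module _ {Ag : Set} (M : Model Ag) where
  open Model M

  Holds : W → Form Ag → Set
  Holds w (⊥f) = Empty
  Holds w (⊤f) = Unit
  Holds w (var p) = V p w
  Holds w (nvar p) = ¬ V p w
  Holds w ((φ ∧f ψ)) = (Holds w φ) × (Holds w ψ)
  Holds w ((φ ∨f ψ)) = (Holds w φ) ⊎ (Holds w ψ)
  Holds w (□ a φ) = ∀ v → R a w v → Holds v φ
  Holds w (◇ a φ) = Σ W (λ v → R a w v × Holds v φ)

-- A sequent is a finite set of formulas (a list, read
-- up to membership).  A cross-sequent is a root sequent together with
-- a list of brackets [H]_a, where a hypersequent H is a nonempty finite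
-- multiset (nonempty list) of cross-sequents.

Sequent : Set → Set
Sequent Ag = List (Form Ag)

data XS (Ag : Set) : Set where
  node : Sequent Ag → List (Ag × List⁺ (XS Ag)) → XS Ag

Hyp : Set → Set
Hyp Ag = List⁺ (XS Ag)

-- Positions of components in a cross-sequent (occurrences; duplicate
-- members of a multiset are distinguished by their membership proofs).
data Pos {Ag : Set} : XS Ag → Set where
  here  : ∀ {S} → Pos S
  there : ∀ {Γ bs a H S} → (a , H) ∈ bs → S ∈ toList H → Pos S →
          Pos (node Γ bs)

module _ {Ag : Set} where

  subtree : {S : XS Ag} → Pos S → XS Ag
  subtree {S} here = S
  subtree (there _ _ p) = subtree p

  comp : {S : XS Ag} → Pos S → Sequent Ag
  comp p with subtree p
  ... | node Γ _ = Γ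

  brackets : {S : XS Ag} → Pos S → List (Ag × Hyp Ag)
  brackets p with subtree p
  ... | node _ bs = bs

  data Child (a : Ag) : {S : XS Ag} → Pos S → Pos S → Set where
    ch-here  : ∀ {Γ bs H S'} (b : (a , H) ∈ bs) (s : S' ∈ toList H) →
               Child a {node Γ bs} here (there b s here)
    ch-there : ∀ {Γ bs c H S'} (b : (c , H) ∈ bs) (s : S' ∈ toList H)
               {p q : Pos S'} → Child a p q →
               Child a {node Γ bs} (there b s p) (there b s q)

  data Sibling (a : Ag) : {S : XS Ag} → Pos S → Pos S → Set where
    sib-here  : ∀ {Γ bs H S₁ S₂} (b : (a , H) ∈ bs)
                (s₁ : S₁ ∈ toList H) (s₂ : S₂ ∈ toList H) →
                Sibling a {node Γ bs} (there b s₁ here) (there b s₂ here)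
    sib-there : ∀ {Γ bs c H S'} (b : (c , H) ∈ bs) (s : S' ∈ toList H)
                {p q : Pos S'} → Sibling a p q →
                Sibling a {node Γ bs} (there b s p) (there b s q)

  InCluster : (a : Ag) {S : XS Ag} → Pos S → Pos S → Set
  InCluster a p q = (p ≡ q) ⊎ Child a q p ⊎ Sibling a p q ⊎ Child a p q

  Proper : XS Ag → Set
  Proper S =
    -- (a) at most one a-bracket per agent in each component
    (∀ (p : Pos S) (a : Ag) {H H' : Hyp Ag}
       (m : (a , H) ∈ brackets p) (m' : (a , H') ∈ brackets p) →
       index m ≡ index m')
    ×
    -- (b) no a-child is an a-parent
    (∀ (a : Ag) (p q : Pos S) → Child a p q →
       ∀ (H : Hyp Ag) → (a , H) ∉ brackets q)

  SatOcc : {S : XS Ag} → Pos S → Form Ag → Set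
  SatOcc p ⊤f        = Empty
  SatOcc p ⊥f        = Unit
  SatOcc p (var x)   = nvar x ∉ comp p
  SatOcc p (nvar x)  = var x ∉ comp p
  SatOcc p (φ ∨f ψ)  = (φ ∈ comp p) × (ψ ∈ comp p)
  SatOcc p (φ ∧f ψ)  = (φ ∈ comp p) ⊎ (ψ ∈ comp p)
  SatOcc p (□ a φ)   = Σ (Pos _) (λ q → InCluster a p q × φ ∈ comp q)
  SatOcc p (◇ a φ)   = ∀ q → InCluster a p q → φ ∈ comp q

  Saturated : XS Ag → Set
  Saturated S = ∀ (p : Pos S) (φ : Form Ag) → φ ∈ comp p → SatOcc p φ

  -- Interpretations and validity.  A labeling is injective, so an
  -- interpretation (labels → W) amounts to an assignment of worlds to
  -- components (positions).
  record Interp (M : Model Ag) (S : XS Ag) : Set where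
    open Model M
    field
      ⟦_⟧  : Pos S → W
      resp : ∀ (a : Ag) (p q : Pos S) → InCluster a p q → R a (⟦ p ⟧) (⟦ q ⟧)

  _,_⊨XS_ : (M : Model Ag) {S : XS Ag} → Interp M S → XS Ag → Set
  M , I ⊨XS S = Σ (Pos _) (λ p → Σ (Form Ag) (λ φ →
                  φ ∈ comp p × Holds M (Interp.⟦_⟧ I p) φ))

  Valid : XS Ag → Set₁
  Valid S = ∀ (M : Model Ag) (I : Interp M S) → M , I ⊨XS S

-- A saturated proper cross-sequent is refuted by its own canonical model.
-- The worlds are the components; p holds at a component iff ¬p occurs in
-- it; and two components are a-related iff they have the same a-centre,
-- namely the a-parent if there is one and the component itself otherwise.
-- Properness (b) makes every a-parent its own a-centre, so this is an
-- equivalence, and with (a) it relates exactly the components of an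
-- a-cluster.  Saturation then shows, by induction on formulas, that every
-- formula of a component is false at that component.
module Submission where

open import Defs
open import Data.Nat using (ℕ; suc)
open import Data.Fin using (Fin)
open import Relation.Nullary using (¬_; yes; no)

open import Data.Fin.Properties using (_≟_; suc-injective)
open import Data.Product using (Σ; ∃; _×_; _,_; proj₁; proj₂)
open import Data.Sum using (_⊎_; inj₁; inj₂)
open import Data.Empty using (⊥-elim)
open import Data.List using (List)
open import Data.List.NonEmpty using (toList)
open import Data.List.Membership.Propositional using (_∈_)
open import Data.List.Relation.Unary.Any using (here; there; index)
open import Relation.Binary.Definitions using (DecidableEquality)
open import Relation.Binary.PropositionalEquality using (_≡_; refl; cong)

∈-index-injective : ∀ {A : Set} {x y : A} {xs : List A} (x∈xs : x ∈ xs) (y∈xs : y ∈ xs) →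
                    index x∈xs ≡ index y∈xs →
                    _≡_ {A = Σ A (_∈ xs)} (x , x∈xs) (y , y∈xs)
∈-index-injective (here refl) (here refl) refl = refl
∈-index-injective (there x∈xs) (there y∈xs) eq
  with ∈-index-injective x∈xs y∈xs (suc-injective eq)
... | refl = refl

module _ {Ag : Set} {a : Ag} where

  Orphan : {S : XS Ag} → Pos S → Set
  Orphan p = ∀ x → ¬ Child a x p

  root-orphan : {S : XS Ag} → Orphan {S} here
  root-orphan x ()

  parent-unique : {S : XS Ag} {x y p : Pos S} → Child a x p → Child a y p → x ≡ y
  parent-unique (ch-here b s)    (ch-here .b .s)    = refl
  parent-unique (ch-here b s)    (ch-there .b .s c) = ⊥-elim (root-orphan _ c)
  parent-unique (ch-there b s c) (ch-here .b .s)    = ⊥-elim (root-orphan _ c)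
  parent-unique (ch-there b s c) (ch-there .b .s d) = cong (there b s) (parent-unique c d)

  parent-has-bracket : {S : XS Ag} {x p : Pos S} → Child a x p → ∃ λ H → (a , H) ∈ brackets x
  parent-has-bracket (ch-here {H = H} b s) = H , b
  parent-has-bracket (ch-there b s c)      = parent-has-bracket c

  sibling⇒common-parent : {S : XS Ag} {p q : Pos S} → Sibling a p q →
                          ∃ λ x → Child a x p × Child a x q
  sibling⇒common-parent (sib-here b s₁ s₂) = here , ch-here b s₁ , ch-here b s₂
  sibling⇒common-parent (sib-there b s sib) with sibling⇒common-parent sib
  ... | x , c₁ , c₂ = there b s x , ch-there b s c₁ , ch-there b s c₂

  InCluster-there : ∀ {Γ bs c H S'} (b : (c , H) ∈ bs) (s : S' ∈ toList H) {p q : Pos S'} →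
                    InCluster a p q → InCluster a {node Γ bs} (there b s p) (there b s q)
  InCluster-there b s (inj₁ refl)               = inj₁ refl
  InCluster-there b s (inj₂ (inj₁ c))           = inj₂ (inj₁ (ch-there b s c))
  InCluster-there b s (inj₂ (inj₂ (inj₁ sib)))  = inj₂ (inj₂ (inj₁ (sib-there b s sib)))
  InCluster-there b s (inj₂ (inj₂ (inj₂ c)))    = inj₂ (inj₂ (inj₂ (ch-there b s c)))

  OneBracket : List (Ag × Hyp Ag) → Set
  OneBracket bs = ∀ {H H'} (m : (a , H) ∈ bs) (m' : (a , H') ∈ bs) → index m ≡ index m'

  children⇒InCluster : {S : XS Ag} {x p q : Pos S} → OneBracket (brackets x) →
                       Child a x p → Child a x q → InCluster a p q
  children⇒InCluster one (ch-here b₁ s₁) (ch-here b₂ s₂)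
    with ∈-index-injective b₁ b₂ (one b₁ b₂)
  ... | refl = inj₂ (inj₂ (inj₁ (sib-here b₁ s₁ s₂)))
  children⇒InCluster one (ch-there b s c₁) (ch-there .b .s c₂) =
    InCluster-there b s (children⇒InCluster one c₁ c₂)

  module _ (_≟ₐ_ : DecidableEquality Ag) where

    parent? : {S : XS Ag} (p : Pos S) → (∃ λ x → Child a x p) ⊎ Orphan p
    parent? here = inj₂ root-orphan
    parent? (there {a = c} b s here) with c ≟ₐ a
    ... | yes refl = inj₁ (here , ch-here b s)
    ... | no c≢a   = inj₂ λ { _ (ch-here _ _) → c≢a refl ; _ (ch-there _ _ d) → root-orphan _ d }
    parent? (there b s p@(there _ _ _)) with parent? p
    ... | inj₁ (x , c) = inj₁ (there b s x , ch-there b s c)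
    ... | inj₂ orphan  = inj₂ λ { _ (ch-there _ _ c) → orphan _ c }

module CanonicalModel {Ag : Set} (_≟ₐ_ : DecidableEquality Ag) (S : XS Ag) (proper : Proper S) where

  parent-orphan : ∀ {a} {x p : Pos S} → Child a x p → Orphan {a = a} x
  parent-orphan {a} {x} c y y-parent-of-x with parent-has-bracket c
  ... | H , m = proj₂ proper a y x y-parent-of-x H m

  CentreOf : Ag → Pos S → Pos S → Set
  CentreOf a c p = Orphan {a = a} c × (c ≡ p ⊎ Child a c p)

  centre-unique : ∀ {a c c' p} → CentreOf a c p → CentreOf a c' p → c ≡ c'
  centre-unique (_ , inj₁ refl) (_ , inj₁ refl) = refl
  centre-unique (o , inj₁ refl) (_ , inj₂ c')   = ⊥-elim (o _ c')
  centre-unique (_ , inj₂ c)    (o , inj₁ refl) = ⊥-elim (o _ c)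
  centre-unique (_ , inj₂ c)    (_ , inj₂ c')   = parent-unique c c'

  centre : ∀ a p → ∃ λ c → CentreOf a c p
  centre a p with parent? _≟ₐ_ p
  ... | inj₁ (x , c)  = x , parent-orphan c , inj₂ c
  ... | inj₂ orphan   = p , orphan , inj₁ refl

  SameCentre : Ag → Pos S → Pos S → Set
  SameCentre a p q = ∃ λ c → CentreOf a c p × CentreOf a c q

  SameCentre-trans : ∀ {a p q r} → SameCentre a p q → SameCentre a q r → SameCentre a p r
  SameCentre-trans (c , cp , cq) (c' , c'q , c'r) with centre-unique cq c'q
  ... | refl = c , cp , c'r

  InCluster⇒SameCentre : ∀ a p q → InCluster a p q → SameCentre a p q
  InCluster⇒SameCentre a p q (inj₁ refl) = let c , cp = centre a p in c , cp , cp
  InCluster⇒SameCentre a p q (inj₂ (inj₁ c)) = q , (parent-orphan c , inj₂ c) , (parent-orphan c , inj₁ refl)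
  InCluster⇒SameCentre a p q (inj₂ (inj₂ (inj₁ sib))) with sibling⇒common-parent sib
  ... | x , c₁ , c₂ = x , (parent-orphan c₁ , inj₂ c₁) , (parent-orphan c₂ , inj₂ c₂)
  InCluster⇒SameCentre a p q (inj₂ (inj₂ (inj₂ c))) = p , (parent-orphan c , inj₁ refl) , (parent-orphan c , inj₂ c)

  SameCentre⇒InCluster : ∀ {a p q} → SameCentre a p q → InCluster a p q
  SameCentre⇒InCluster (_ , (_ , inj₁ refl) , (_ , inj₁ refl)) = inj₁ refl
  SameCentre⇒InCluster (_ , (_ , inj₁ refl) , (_ , inj₂ c))    = inj₂ (inj₂ (inj₂ c))
  SameCentre⇒InCluster (_ , (_ , inj₂ c)    , (_ , inj₁ refl)) = inj₂ (inj₁ c)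
  SameCentre⇒InCluster {a} (x , (_ , inj₂ c₁) , (_ , inj₂ c₂)) =
    children⇒InCluster (proj₁ proper x a) c₁ c₂

  model : Model Ag
  model = record
    { W   = Pos S
    ; w₀  = here
    ; R   = SameCentre
    ; Req = λ a → record
      { refl  = λ {p} → InCluster⇒SameCentre a p p (inj₁ refl)
      ; sym   = λ { (c , cp , cq) → c , cq , cp }
      ; trans = SameCentre-trans
      }
    ; V   = λ x p → nvar x ∈ comp p
    }

  components : Interp model S
  components = record { ⟦_⟧ = λ p → p ; resp = InCluster⇒SameCentre }

  module _ (sat : Saturated S) where

    saturated⇒false : ∀ φ p → φ ∈ comp p → ¬ Holds model p φ
    saturated⇒false ⊥f       p φ∈p ()
    saturated⇒false ⊤f       p φ∈p _ = sat p ⊤f φ∈p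
    saturated⇒false (var x)  p φ∈p ¬x∈p = sat p (var x) φ∈p ¬x∈p
    saturated⇒false (nvar x) p φ∈p ¬x∉p = ¬x∉p φ∈p
    saturated⇒false (φ ∧f ψ) p φ∧ψ∈p (hφ , hψ) with sat p _ φ∧ψ∈p
    ... | inj₁ φ∈p = saturated⇒false φ p φ∈p hφ
    ... | inj₂ ψ∈p = saturated⇒false ψ p ψ∈p hψ
    saturated⇒false (φ ∨f ψ) p φ∨ψ∈p (inj₁ hφ) = saturated⇒false φ p (proj₁ (sat p _ φ∨ψ∈p)) hφ
    saturated⇒false (φ ∨f ψ) p φ∨ψ∈p (inj₂ hψ) = saturated⇒false ψ p (proj₂ (sat p _ φ∨ψ∈p)) hψ
    saturated⇒false (□ a φ)  p □φ∈p h with sat p _ □φ∈p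
    ... | q , pq , φ∈q = saturated⇒false φ q φ∈q (h q (InCluster⇒SameCentre a p q pq))
    saturated⇒false (◇ a φ)  p ◇φ∈p (q , pq , hφ) =
      saturated⇒false φ q (sat p _ ◇φ∈p q (SameCentre⇒InCluster pq)) hφ

    saturated⇒¬valid : ¬ Valid S
    saturated⇒¬valid valid with valid model components
    ... | p , φ , φ∈p , φ-true = saturated⇒false φ p φ∈p φ-true

lemma4 : (k : ℕ) (S : XS (Fin (suc k))) →
         Proper S → Saturated S → ¬ Valid S
lemma4 k S proper = CanonicalModel.saturated⇒¬valid _≟_ S proper
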